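{- Let $\mathcal{A},\mathcal{B}$ be complete context trees over the same alphabet $A$. Then $\mathcal{A}\subseteq\mathcal{B}$ if and only if for every $b\in\mathcal{B}^*$ there exists $a\in\mathcal{A}^*$ with $a\prec b$.
   Context: Fix a finite alphabet $A=\{a_1,\dots,a_n\}$. A string is a finite sequence of letters of $A$ (possibly empty); $\overline{uv}$ denotes concatenation. A string $v$ is a postfix of $s$, written $v\prec s$, if $s=\overline{wv}$ for some string $w$. A context tree over $A$ is a finite rooted tree in which every non-root vertex is labeled by a letter of $A$, with no two siblings carrying the same label. A context is the string read along the path from a leaf to the root (leaf's label first, label of the root's child last); $\mathcal{T}^*$ is the set of contexts of $\mathcal{T}$. $\mathcal{T}$ is complete if every node is either a leaf or has exactly $n$ children. For nonempty context trees $\mathcal{A},\mathcal{B}$, $\mathcal{A}\subseteq\mathcal{B}$ ("contained at the root") means: for every $a\in\mathcal{A}^*$ there is $b\in\mathcal{B}^*$ with $a\prec b$. -}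

module Defs where

open import Data.Nat using (ℕ)
open import Data.Fin using (Fin)
open import Data.List using (List; []; _∷_; _++_; map; length)
open import Data.List.Relation.Unary.All using (All)
open import Data.List.Relation.Unary.Any using (Any)
open import Data.List.Relation.Unary.Unique.Propositional using (Unique)
open import Data.List.Membership.Propositional using (_∈_)
open import Data.Product using (_×_; _,_; proj₁; ∃; ∃-syntax; Σ)
open import Data.Sum using (_⊎_)
open import Relation.Binary.PropositionalEquality using (_≡_)

Str : ℕ → Set
Str n = List (Fin n)

_≺_ : ∀ {n} → Str n → Str n → Set
_≺_ {n} v s = Σ (Str n) λ w → s ≡ w ++ v

data Tree (n : ℕ) : Set where
  node : List (Fin n × Tree n) → Tree n

children : ∀ {n} → Tree n → List (Fin n × Tree n)
children (node cs) = cs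

mutual
  data WellLabelled {n : ℕ} : Tree n → Set where
    wl : ∀ {cs} → Unique (map proj₁ cs) → AllWL cs → WellLabelled (node cs)

  data AllWL {n : ℕ} : List (Fin n × Tree n) → Set where
    []  : AllWL []
    _∷_ : ∀ {a t cs} → WellLabelled t → AllWL cs → AllWL ((a , t) ∷ cs)

mutual
  data Complete {n : ℕ} : Tree n → Set where
    leaf  : Complete (node [])
    inner : ∀ {cs} → length cs ≡ n → AllComplete cs → Complete (node cs)

  data AllComplete {n : ℕ} : List (Fin n × Tree n) → Set where
    []  : AllComplete []
    _∷_ : ∀ {a t cs} → Complete t → AllComplete cs → AllComplete ((a , t) ∷ cs)

record ContextTree (n : ℕ) : Set where
  constructor ctree
  field
    tree : Tree n
    wellLabelled : WellLabelled tree

-- IsContext t s : s is the string read from a leaf of t up to the root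
-- (leaf's label first, label of the root's child last).
data IsContext {n : ℕ} : Tree n → Str n → Set where
  here  : IsContext (node []) []
  there : ∀ {cs a t s} → (a , t) ∈ cs → IsContext t s →
          IsContext (node cs) (s ++ (a ∷ []))

_∈*_ : ∀ {n} → Str n → ContextTree n → Set
c ∈* T = IsContext (ContextTree.tree T) c

IsComplete : ∀ {n} → ContextTree n → Set
IsComplete T = Complete (ContextTree.tree T)

_⊆ᶜ_ : ∀ {n} → ContextTree n → ContextTree n → Set
_⊆ᶜ_ {n} 𝒜 ℬ = (a : Str n) → a ∈* 𝒜 → Σ (Str n) λ b → b ∈* ℬ × (a ≺ b)

-- In a well-labelled context tree no context is a proper postfix of another,
-- and if the tree is also complete then every string is comparable with some
-- context: reading the string from its last letter, we can walk down the tree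
-- (every letter labels a child) until we reach a leaf or run out of letters.
-- Given b ∈ ℬ*, comparability in 𝒜 either yields a ≺ b directly, or b ≺ a for
-- some a ∈ 𝒜*; then 𝒜 ⊆ ℬ gives a ≺ b' ∈ ℬ*, so b ≺ b' and hence b' = b.
-- The converse is the same argument with the roles of the trees exchanged.
module Submission where

open import Defs
open import Data.Nat using (ℕ; suc; _<_)
open import Data.Nat.Properties using (n<1+n)
open import Data.Fin as Fin using (Fin)
open import Data.Fin.Properties using (pigeonhole; <-irrefl) renaming (_≟_ to _≟ᶠ_)
open import Data.Product using (Σ; _×_; _,_; proj₁; proj₂; ∃)
open import Data.Sum using (_⊎_; inj₁; inj₂)
open import Data.List using (List; []; _∷_; _++_; _∷ʳ_; map; length; lookup)
open import Data.List.Properties using (++-identityʳ; ++-assoc; ∷ʳ-injective; length-map)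
open import Data.List.Reverse using (Reverse; reverseView; []; _∶_∶ʳ_)
import Data.List.Relation.Unary.All as All
open import Data.List.Relation.Unary.All.Properties using (¬Any⇒All¬)
open import Data.List.Relation.Unary.AllPairs using (_∷_)
open import Data.List.Relation.Unary.Any using (here; there)
open import Data.List.Relation.Unary.Unique.Propositional using (Unique)
open import Data.List.Membership.Propositional using (_∈_)
open import Data.List.Membership.Propositional.Properties using (∈-lookup; ∈-map⁺; ∈-map⁻)
import Data.List.Membership.DecPropositional as DecMembership
open import Relation.Nullary using (yes; no; contradiction)
open import Relation.Binary.PropositionalEquality
open import Function.Bundles using (_⇔_; mk⇔)

private
  variable
    n : ℕ

module _ {a b} {A : Set a} {B : Set b} where

  Unique-map⇒injective : ∀ {f : A → B} {xs x y} → Unique (map f xs) →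
                         x ∈ xs → y ∈ xs → f x ≡ f y → x ≡ y
  Unique-map⇒injective         _       (here refl) (here refl) _     = refl
  Unique-map⇒injective {f = f} (p ∷ _) (here refl) (there y∈)  fx≡fy =
    contradiction fx≡fy (All.lookup p (∈-map⁺ f y∈))
  Unique-map⇒injective {f = f} (p ∷ _) (there x∈)  (here refl) fx≡fy =
    contradiction (sym fx≡fy) (All.lookup p (∈-map⁺ f x∈))
  Unique-map⇒injective         (_ ∷ u) (there x∈)  (there y∈)  fx≡fy =
    Unique-map⇒injective u x∈ y∈ fx≡fy

module _ {a} {A : Set a} where

  Unique⇒lookup-injective : ∀ {xs : List A} → Unique xs →
                            ∀ i j → lookup xs i ≡ lookup xs j → i ≡ j
  Unique⇒lookup-injective (_ ∷ _) Fin.zero    Fin.zero    _ = refl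
  Unique⇒lookup-injective (p ∷ _) Fin.zero    (Fin.suc j) e = contradiction e (All.lookup p (∈-lookup j))
  Unique⇒lookup-injective (p ∷ _) (Fin.suc i) Fin.zero    e = contradiction (sym e) (All.lookup p (∈-lookup i))
  Unique⇒lookup-injective (_ ∷ u) (Fin.suc i) (Fin.suc j) e = cong Fin.suc (Unique⇒lookup-injective u i j e)

Unique-full-length⇒∈ : (xs : List (Fin n)) → Unique xs → length xs ≡ n → ∀ x → x ∈ xs
Unique-full-length⇒∈ {n} xs u len x with DecMembership._∈?_ (_≟ᶠ_ {n}) x xs
... | yes x∈xs = x∈xs
... | no  x∉xs with pigeonhole (subst (n <_) (cong suc (sym len)) (n<1+n n)) (lookup (x ∷ xs))
...   | i , j , i<j , same =
        contradiction i<j (<-irrefl (Unique⇒lookup-injective (¬Any⇒All¬ xs x∉xs ∷ u) i j same))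

[]≺ : (s : Str n) → [] ≺ s
[]≺ s = s , sym (++-identityʳ s)

≺-trans : {u v w : Str n} → u ≺ v → v ≺ w → u ≺ w
≺-trans {u = u} (p , refl) (q , refl) = q ++ p , sym (++-assoc q p u)

≺-∷ʳ : {u v : Str n} (x : Fin n) → u ≺ v → (u ∷ʳ x) ≺ (v ∷ʳ x)
≺-∷ʳ {u = u} x (p , refl) = p , ++-assoc p u (x ∷ [])

AllComplete-lookup : ∀ {cs : List (Fin n × Tree n)} {a t} → AllComplete cs → (a , t) ∈ cs → Complete t
AllComplete-lookup (ct ∷ _)  (here refl) = ct
AllComplete-lookup (_ ∷ act) (there m)   = AllComplete-lookup act m

AllWL-lookup : ∀ {cs : List (Fin n × Tree n)} {a t} → AllWL cs → (a , t) ∈ cs → WellLabelled t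
AllWL-lookup (wt ∷ _)  (here refl) = wt
AllWL-lookup (_ ∷ awt) (there m)   = AllWL-lookup awt m

child-unique : ∀ {cs : List (Fin n × Tree n)} {a t t'} → Unique (map proj₁ cs) →
               (a , t) ∈ cs → (a , t') ∈ cs → t ≡ t'
child-unique u m m' = cong proj₂ (Unique-map⇒injective u m m' refl)

child-exists : ∀ {cs : List (Fin n × Tree n)} → Unique (map proj₁ cs) → length cs ≡ n →
               ∀ a → ∃ λ t → (a , t) ∈ cs
child-exists {cs = cs} u len a
  with ∈-map⁻ proj₁ (Unique-full-length⇒∈ (map proj₁ cs) u (trans (length-map proj₁ cs) len) a)
... | (_ , t) , m , refl = t , m

context-exists : (t : Tree n) → ∃ (IsContext t)
context-exists (node [])             = [] , here
context-exists (node ((a , t) ∷ _)) with context-exists t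
... | c , c∈ = c ∷ʳ a , there (here refl) c∈

Comparable : Tree n → Str n → Set
Comparable t s = (∃ λ c → IsContext t c × c ≺ s) ⊎ (∃ λ c → IsContext t c × s ≺ c)

complete⇒comparable : ∀ {t : Tree n} → Complete t → WellLabelled t → ∀ s → Comparable t s
complete⇒comparable ct wt s = go ct wt (reverseView s)
  where
  go : ∀ {t s} → Complete t → WellLabelled t → Reverse s → Comparable t s
  go {t = t} _ _ [] with context-exists t
  ... | c , c∈ = inj₂ (c , c∈ , []≺ c)
  go leaf _ (xs ∶ _ ∶ʳ x) = inj₁ ([] , here , []≺ (xs ∷ʳ x))
  go (inner len act) (wl u awt) (_ ∶ r ∶ʳ x) with child-exists u len x
  ... | _ , m with go (AllComplete-lookup act m) (AllWL-lookup awt m) r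
  ...   | inj₁ (c , c∈ , c≺s) = inj₁ (c ∷ʳ x , there m c∈ , ≺-∷ʳ x c≺s)
  ...   | inj₂ (c , c∈ , s≺c) = inj₂ (c ∷ʳ x , there m c∈ , ≺-∷ʳ x s≺c)

contexts-postfix-free : ∀ {t : Tree n} {c c'} → WellLabelled t →
                        IsContext t c → IsContext t c' → c' ≺ c → c ≡ c'
contexts-postfix-free _ here          here          _ = refl
contexts-postfix-free _ (there () _)  here          _
contexts-postfix-free _ here          (there () _)  _
contexts-postfix-free (wl u awt) (there {a = a} {s = s} m c∈) (there {a = a'} {s = s'} m' c'∈) (w , eq)
  with ∷ʳ-injective s (w ++ s') (trans eq (sym (++-assoc w s' (a' ∷ []))))
... | s≡ws' , refl with child-unique u m m'
...   | refl = cong (_∷ʳ a) (contexts-postfix-free (AllWL-lookup awt m) c∈ c'∈ (w , s≡ws'))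

lemma1 : (n : ℕ) (𝒜 ℬ : ContextTree n) → IsComplete 𝒜 → IsComplete ℬ →
         (𝒜 ⊆ᶜ ℬ) ⇔ ((b : Str n) → b ∈* ℬ → Σ (Str n) λ a → a ∈* 𝒜 × (a ≺ b))
lemma1 n (ctree tA wA) (ctree tB wB) cA cB = mk⇔ to from
  where
  to : ctree tA wA ⊆ᶜ ctree tB wB → ∀ b → IsContext tB b → ∃ λ a → IsContext tA a × a ≺ b
  to A⊆B b b∈ with complete⇒comparable cA wA b
  ... | inj₁ found = found
  ... | inj₂ (a , a∈ , b≺a) with A⊆B a a∈
  ...   | b' , b'∈ , a≺b' =
          a , a∈ , subst (a ≺_) (contexts-postfix-free wB b'∈ b∈ (≺-trans b≺a a≺b')) a≺b'

  from : (∀ b → IsContext tB b → ∃ λ a → IsContext tA a × a ≺ b) → ctree tA wA ⊆ᶜ ctree tB wB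
  from below a a∈ with complete⇒comparable cB wB a
  ... | inj₂ found = found
  ... | inj₁ (b , b∈ , b≺a) with below b b∈
  ...   | a' , a'∈ , a'≺b =
          b , b∈ , subst (_≺ b) (sym (contexts-postfix-free wA a∈ a'∈ (≺-trans a'≺b b≺a))) a'≺b
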